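{- Let $G$ be a connected graph on $q\ge 2$ vertices with distance matrix $M$, and define \[ r(G) = \min\left\{\frac{\max_i (Mw)_i - \min_i (Mw)_i}{\gcd_{i<j}\big((Mw)_i-(Mw)_j\big)} \;:\; w\in \mathbb{Z}^q,\ \sum_i w_i = 0,\ (Mw)_i \neq (Mw)_j \text{ for all } i\neq j\right\} + 1. \] The following are equivalent: (1) $r(G)=q$. (2) There exists $w\in\mathbb{Z}^q$ with $\sum_i w_i=0$ such that the vector $Mw$, after sorting its coordinates, is an arithmetic progression with nonzero common difference. (3) There exists a permutation $\pi$ of $[q]$ such that the vector $(\pi(1),\dots,\pi(q),0)^T$ lies in the column space (as a subspace of $\mathbb{Q}^{q+1}$) of the matrix $\begin{pmatrix} M & \mathbf{1}\\ \mathbf{1}^T & 0\end{pmatrix}$, where $\mathbf{1}$ is the $q$-dimensional all-ones column vector.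
   Context: The distance matrix $M$ of a graph with vertices $v_1,\dots,v_q$ is the $q\times q$ matrix with $M_{ij}=d(v_i,v_j)$, the graph distance. -}

module Defs where

open import Level using (0ℓ)
open import Data.Nat as ℕ using (ℕ; zero; suc)
open import Data.Fin as Fin using (Fin; zero; suc; toℕ; splitAt)
open import Data.Fin.Permutation using (Permutation′; _⟨$⟩ʳ_)
open import Data.Integer as ℤ using (ℤ; +_; 0ℤ; 1ℤ)
open import Data.Integer.GCD using (gcd)
open import Data.Rational as ℚ using (ℚ)
open import Data.Sum using (_⊎_; inj₁; inj₂)
open import Data.Product using (Σ; ∃; ∃-syntax; _×_; _,_)
open import Relation.Binary.PropositionalEquality using (_≡_; _≢_)
open import Relation.Nullary using (¬_)

record Graph (q : ℕ) : Set₁ where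
  field
    Adj   : Fin q → Fin q → Set
    sym   : ∀ {u v} → Adj u v → Adj v u
    irrefl : ∀ {u} → ¬ Adj u u
open Graph public

data Walk {q} (G : Graph q) : Fin q → Fin q → ℕ → Set where
  here  : ∀ {u} → Walk G u u 0
  step  : ∀ {u v w n} → Adj G u v → Walk G v w n → Walk G u w (suc n)

Connected : ∀ {q} → Graph q → Set
Connected G = ∀ u v → ∃[ n ] Walk G u v n

IsDistance : ∀ {q} → Graph q → Fin q → Fin q → ℕ → Set
IsDistance G u v d = Walk G u v d × (∀ m → Walk G u v m → d ℕ.≤ m)

IsDistanceMatrix : ∀ {q} → Graph q → (Fin q → Fin q → ℕ) → Set
IsDistanceMatrix G M = ∀ i j → IsDistance G i j (M i j)

sumℤ : ∀ {n} → (Fin n → ℤ) → ℤ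
sumℤ {zero}  f = 0ℤ
sumℤ {suc n} f = f zero ℤ.+ sumℤ (λ i → f (suc i))

sumℚ : ∀ {n} → (Fin n → ℚ) → ℚ
sumℚ {zero}  f = ℚ.0ℚ
sumℚ {suc n} f = f zero ℚ.+ sumℚ (λ i → f (suc i))

-- maximum / minimum of the coordinates (value on the empty vector is an
-- irrelevant default 0; only used for q ≥ 2)
maxℤ : ∀ {n} → (Fin n → ℤ) → ℤ
maxℤ {zero}        f = 0ℤ
maxℤ {suc zero}    f = f zero
maxℤ {suc (suc n)} f = f zero ℤ.⊔ maxℤ (λ i → f (suc i))

minℤ : ∀ {n} → (Fin n → ℤ) → ℤ
minℤ {zero}        f = 0ℤ
minℤ {suc zero}    f = f zero
minℤ {suc (suc n)} f = f zero ℤ.⊓ minℤ (λ i → f (suc i))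

gcdAll : ∀ {n} → (Fin n → ℤ) → ℤ
gcdAll {zero}  f = 0ℤ
gcdAll {suc n} f = gcd (f zero) (gcdAll (λ i → f (suc i)))

gcdPairs : ∀ {n} → (Fin n → ℤ) → ℤ
gcdPairs {zero}  v = 0ℤ
gcdPairs {suc n} v =
  gcd (gcdAll (λ j → v zero ℤ.- v (suc j))) (gcdPairs (λ i → v (suc i)))

mulVec : ∀ {q} → (Fin q → Fin q → ℕ) → (Fin q → ℤ) → Fin q → ℤ
mulVec M w i = sumℤ (λ j → + (M i j) ℤ.* w j)

DistinctCoords : ∀ {q} → (Fin q → ℤ) → Set
DistinctCoords v = ∀ i j → i ≢ j → v i ≢ v j

-- ρ is the value (max_i v_i - min_i v_i) / gcd_{i<j}(v_i - v_j) for v = Mw,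
-- with w admissible (Σ w = 0, Mw has pairwise distinct coordinates).
-- (For such w and q ≥ 2 the gcd is positive and divides max - min.)
RatioValue : ∀ {q} → (Fin q → Fin q → ℕ) → ℕ → Set
RatioValue M ρ =
  ∃[ w ] (sumℤ w ≡ 0ℤ × DistinctCoords (mulVec M w) ×
          (+ ρ) ℤ.* gcdPairs (mulVec M w)
            ≡ maxℤ (mulVec M w) ℤ.- minℤ (mulVec M w))

IsMinimum : (ℕ → Set) → ℕ → Set
IsMinimum P m = P m × (∀ k → P k → m ℕ.≤ k)

IsR : ∀ {q} → (Fin q → Fin q → ℕ) → ℕ → Set
IsR M r = ∃[ m ] (IsMinimum (RatioValue M) m × r ≡ m ℕ.+ 1)

SortedAPNonzero : ∀ {q} → (Fin q → ℤ) → Set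
SortedAPNonzero {q} v =
  Σ (Permutation′ q) λ σ → ((∀ k l → toℕ k ℕ.≤ toℕ l → v (σ ⟨$⟩ʳ k) ℤ.≤ v (σ ⟨$⟩ʳ l)) ×
          ∃[ a ] ∃[ d ] (d ≢ 0ℤ × (∀ k → v (σ ⟨$⟩ʳ k) ≡ a ℤ.+ (+ toℕ k) ℤ.* d)))

ℕ→ℚ : ℕ → ℚ
ℕ→ℚ n = (+ n) ℚ./ 1

bordered : ∀ {q} → (Fin q → Fin q → ℕ) → Fin (q ℕ.+ 1) → Fin (q ℕ.+ 1) → ℚ
bordered {q} M k l with splitAt q k | splitAt q l
... | inj₁ i | inj₁ j = ℕ→ℚ (M i j)
... | inj₁ i | inj₂ _ = ℚ.1ℚ
... | inj₂ _ | inj₁ j = ℚ.1ℚ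
... | inj₂ _ | inj₂ _ = ℚ.0ℚ

-- the vector (π(1), …, π(q), 0)ᵀ, with π a permutation of [q] = {1,…,q}
permVec : ∀ {q} → Permutation′ q → Fin (q ℕ.+ 1) → ℚ
permVec {q} π k with splitAt q k
... | inj₁ i = ℕ→ℚ (suc (toℕ (π ⟨$⟩ʳ i)))
... | inj₂ _ = ℚ.0ℚ

InColumnSpace : ∀ {m n} → (Fin m → Fin n → ℚ) → (Fin m → ℚ) → Set
InColumnSpace {m} {n} A b = Σ (Fin n → ℚ) λ x → (∀ k → sumℚ (λ l → A k l ℚ.* x l) ≡ b k)

-- The levels k_i := (v_i - min v) / g of a vector v with distinct coordinates, where g is
-- the gcd of its differences, are distinct naturals bounded by the ratio
-- ρ = (max v - min v) / g; hence q ≤ ρ + 1, with equality exactly when the levels are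
-- 0, …, q - 1, i.e. when v sorted is an arithmetic progression, whose gcd of differences
-- is its common difference d and whose ratio is therefore q - 1.  This gives (1) ⇔ (2).
-- For (2) ⇔ (3), Mw = a + d·π(i) with Σ w = 0 is, after dividing by d, the same as
-- x = (w/d, 1 - a/d) solving the bordered system with right-hand side (π + 1, 0); a
-- rational solution is turned back into an integral w by clearing denominators.
module Submission where

open import Defs hiding (sym)
open import Data.Nat as ℕ using (ℕ; zero; suc; _≤_; z≤n; s≤s)
import Data.Nat.Properties as ℕP
import Data.Nat.Divisibility as ℕD
open import Data.Fin as Fin using (Fin; zero; suc; toℕ; fromℕ; fromℕ<; punchOut; _↑ˡ_; _↑ʳ_; splitAt)
import Data.Fin.Properties as FinP
open import Data.Fin.Permutation using (Permutation′; permutation; flip; _⟨$⟩ʳ_; _⟨$⟩ˡ_; inverseʳ)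
open import Data.Integer as ℤ using (ℤ; +_; -[1+_]; 0ℤ; ∣_∣; +≤+)
import Data.Integer.Properties as ℤP
open import Data.Integer.Divisibility using (_∣_)
open import Data.Integer.GCD using (gcd[i,j]∣i; gcd[i,j]∣j; gcd-greatest)
import Data.Integer.Solver as ℤSolver
open import Data.Rational as ℚ using (ℚ; toℚᵘ)
import Data.Rational.Properties as ℚP
import Data.Rational.Solver as ℚSolver
open import Data.Rational.Unnormalised as ℚᵘ using (mkℚᵘ; *≡*) renaming (_≃_ to _≃ᵘ_)
import Data.Rational.Unnormalised.Properties as ℚᵘP
open import Algebra.Properties.AbelianGroup ℤP.+-0-abelianGroup
  using (⁻¹-anti-homo‿-) renaming (∙-cancelʳ to +-cancelʳ-≡)
open import Data.Product using (Σ; ∃-syntax; _×_; _,_; proj₁; proj₂)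
open import Data.Sum using (inj₁; inj₂; [_,_])
open import Function using (_∘_)
open import Function.Bundles using (_⇔_; mk⇔; Equivalence)
open import Function.Definitions using (Injective)
open import Relation.Nullary using (yes; no; contradiction)
open import Relation.Binary.PropositionalEquality hiding ([_])

maxℤ-upper : ∀ {n} (f : Fin (suc n) → ℤ) i → f i ℤ.≤ maxℤ f
maxℤ-upper {zero}  f zero    = ℤP.≤-refl
maxℤ-upper {suc n} f zero    = ℤP.i≤i⊔j (f zero) _
maxℤ-upper {suc n} f (suc i) = ℤP.≤-trans (maxℤ-upper (f ∘ suc) i) (ℤP.i≤j⊔i (f zero) _)

maxℤ-attained : ∀ {n} (f : Fin (suc n) → ℤ) → ∃[ i ] maxℤ f ≡ f i
maxℤ-attained {zero}  f = zero , refl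
maxℤ-attained {suc n} f with ℤP.⊔-sel (f zero) (maxℤ (f ∘ suc))
... | inj₁ max≡f₀ = zero , max≡f₀
... | inj₂ max≡max′ with i , max′≡fᵢ ← maxℤ-attained (f ∘ suc) = suc i , trans max≡max′ max′≡fᵢ

minℤ-lower : ∀ {n} (f : Fin (suc n) → ℤ) i → minℤ f ℤ.≤ f i
minℤ-lower {zero}  f zero    = ℤP.≤-refl
minℤ-lower {suc n} f zero    = ℤP.i⊓j≤i (f zero) _
minℤ-lower {suc n} f (suc i) = ℤP.≤-trans (ℤP.i⊓j≤j (f zero) _) (minℤ-lower (f ∘ suc) i)

minℤ-attained : ∀ {n} (f : Fin (suc n) → ℤ) → ∃[ i ] minℤ f ≡ f i
minℤ-attained {zero}  f = zero , refl
minℤ-attained {suc n} f with ℤP.⊓-sel (f zero) (minℤ (f ∘ suc))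
... | inj₁ min≡f₀ = zero , min≡f₀
... | inj₂ min≡min′ with i , min′≡fᵢ ← minℤ-attained (f ∘ suc) = suc i , trans min≡min′ min′≡fᵢ

gcdAll-divides : ∀ {n} (f : Fin n → ℤ) i → gcdAll f ∣ f i
gcdAll-divides f zero    = gcd[i,j]∣i (f zero) (gcdAll (f ∘ suc))
gcdAll-divides f (suc i) =
  ℕD.∣-trans (gcd[i,j]∣j (f zero) (gcdAll (f ∘ suc))) (gcdAll-divides (f ∘ suc) i)

gcdAll-greatest : ∀ {n} (f : Fin n → ℤ) {c} → (∀ i → c ∣ f i) → c ∣ gcdAll f
gcdAll-greatest {zero}  f c∣f = ℕD._∣0 _
gcdAll-greatest {suc n} f {c} c∣f =
  gcd-greatest {f zero} {gcdAll (f ∘ suc)} {c} (c∣f zero)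
    (gcdAll-greatest (f ∘ suc) {c} (c∣f ∘ suc))

∣i-j∣≡∣j-i∣ : ∀ i j → ∣ i ℤ.- j ∣ ≡ ∣ j ℤ.- i ∣
∣i-j∣≡∣j-i∣ i j = trans (sym (ℤP.∣-i∣≡∣i∣ (i ℤ.- j))) (cong ∣_∣ (⁻¹-anti-homo‿- i j))

gcdPairs-divides : ∀ {n} (v : Fin n → ℤ) i j → gcdPairs v ∣ v i ℤ.- v j
gcdPairs-divides v zero    zero    rewrite ℤP.+-inverseʳ (v zero) = ℕD._∣0 _
gcdPairs-divides v zero    (suc j) =
  ℕD.∣-trans (gcd[i,j]∣i (gcdAll (λ k → v zero ℤ.- v (suc k))) (gcdPairs (v ∘ suc)))
             (gcdAll-divides (λ k → v zero ℤ.- v (suc k)) j)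
gcdPairs-divides v (suc i) zero    =
  subst (∣ gcdPairs v ∣ ℕD.∣_) (∣i-j∣≡∣j-i∣ (v zero) (v (suc i))) (gcdPairs-divides v zero (suc i))
gcdPairs-divides v (suc i) (suc j) =
  ℕD.∣-trans (gcd[i,j]∣j (gcdAll (λ k → v zero ℤ.- v (suc k))) (gcdPairs (v ∘ suc)))
             (gcdPairs-divides (v ∘ suc) i j)

gcdPairs-greatest : ∀ {n} (v : Fin n → ℤ) {c} → (∀ i j → c ∣ v i ℤ.- v j) → c ∣ gcdPairs v
gcdPairs-greatest {zero}  v c∣v = ℕD._∣0 _
gcdPairs-greatest {suc n} v {c} c∣v =
  gcd-greatest {gcdAll (λ k → v zero ℤ.- v (suc k))} {gcdPairs (v ∘ suc)} {c}
    (gcdAll-greatest _ {c} (c∣v zero ∘ suc))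
    (gcdPairs-greatest (v ∘ suc) {c} λ i j → c∣v (suc i) (suc j))

injective⇒∃-preimage : ∀ {n} {f : Fin n → Fin n} → Injective _≡_ _≡_ f → ∀ k → ∃[ i ] f i ≡ k
injective⇒∃-preimage {suc n} {f} f-inj k with FinP.any? (λ i → f i FinP.≟ k)
... | yes preimage = preimage
... | no ∄preimage = contradiction (FinP.injective⇒≤ punchOut∘f-injective) ℕP.1+n≰n
  where
  k≢f : ∀ i → k ≢ f i
  k≢f i k≡fi = ∄preimage (i , sym k≡fi)
  punchOut∘f-injective : Injective _≡_ _≡_ (λ i → punchOut (k≢f i))
  punchOut∘f-injective {i} {j} = f-inj ∘ FinP.punchOut-injective (k≢f i) (k≢f j)

injective⇒inverse : ∀ {n} {f : Fin n → Fin n} → Injective _≡_ _≡_ f →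
                    Σ (Permutation′ n) λ σ → ∀ k → f (σ ⟨$⟩ʳ k) ≡ k
injective⇒inverse {f = f} f-inj =
  permutation (proj₁ ∘ preimage) f (λ i → f-inj (proj₂ (preimage (f i)))) (proj₂ ∘ preimage) ,
  proj₂ ∘ preimage
  where
  preimage : ∀ k → ∃[ i ] f i ≡ k
  preimage = injective⇒∃-preimage f-inj

record IncreasingAP {q} (v : Fin q → ℤ) : Set where
  field
    order : Permutation′ q
    first : ℤ
    d-1   : ℕ
    along : ∀ k → v (order ⟨$⟩ʳ k) ≡ first ℤ.+ + toℕ k ℤ.* + suc d-1

  d : ℤ
  d = + suc d-1

  rank : Fin q → ℕ
  rank i = toℕ (order ⟨$⟩ˡ i)

  v≡first+rank*d : ∀ i → v i ≡ first ℤ.+ + rank i ℤ.* d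
  v≡first+rank*d i = trans (cong v (sym (inverseʳ order))) (along (order ⟨$⟩ˡ i))

  along-mono : ∀ {k l} → k ≤ l → first ℤ.+ + k ℤ.* d ℤ.≤ first ℤ.+ + l ℤ.* d
  along-mono k≤l = ℤP.+-monoʳ-≤ first (ℤP.*-monoʳ-≤-nonNeg d (+≤+ k≤l))

  differences : ∀ i j → v i ℤ.- v j ≡ (+ rank i ℤ.- + rank j) ℤ.* d
  differences i j rewrite v≡first+rank*d i | v≡first+rank*d j =
    solve 4 (λ a x y d → (a :+ x :* d) :- (a :+ y :* d) := (x :- y) :* d)
            refl first (+ rank i) (+ rank j) d
    where open ℤSolver.+-*-Solver

increasingAP⇒sortedAPNonzero : ∀ {q} {v : Fin q → ℤ} → IncreasingAP v → SortedAPNonzero v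
increasingAP⇒sortedAPNonzero {v = v} P = order , sorted , first , d , (λ ()) , along
  where
  open IncreasingAP P
  sorted : ∀ k l → toℕ k ≤ toℕ l → v (order ⟨$⟩ʳ k) ℤ.≤ v (order ⟨$⟩ʳ l)
  sorted k l k≤l = subst₂ ℤ._≤_ (sym (along k)) (sym (along l)) (along-mono k≤l)

[a+1d]-[a+0d]≡d : ∀ a d → (a ℤ.+ + 1 ℤ.* d) ℤ.- (a ℤ.+ + 0 ℤ.* d) ≡ d
[a+1d]-[a+0d]≡d = solve 2 (λ a d → (a :+ con (+ 1) :* d) :- (a :+ con (+ 0) :* d) := d) refl
  where open ℤSolver.+-*-Solver

a+0d≤a+1d⇒0≤d : ∀ a d → a ℤ.+ + 0 ℤ.* d ℤ.≤ a ℤ.+ + 1 ℤ.* d → 0ℤ ℤ.≤ d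
a+0d≤a+1d⇒0≤d a d le = subst (0ℤ ℤ.≤_) ([a+1d]-[a+0d]≡d a d) (ℤP.i≤j⇒0≤j-i le)

sortedAPNonzero⇒increasingAP : ∀ {n} {v : Fin (suc (suc n)) → ℤ} → SortedAPNonzero v → IncreasingAP v
sortedAPNonzero⇒increasingAP (σ , sorted , a , + zero , d≢0 , along) = contradiction refl d≢0
sortedAPNonzero⇒increasingAP (σ , sorted , a , + suc d-1 , d≢0 , along) = record
  { order = σ ; first = a ; d-1 = d-1 ; along = along }
sortedAPNonzero⇒increasingAP (σ , sorted , a , -[1+ d-1 ] , d≢0 , along)
  with () ← a+0d≤a+1d⇒0≤d a _
               (subst₂ ℤ._≤_ (along zero) (along (suc zero)) (sorted zero (suc zero) z≤n))

module _ {n} {v : Fin (suc (suc n)) → ℤ} (P : IncreasingAP v) where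
  open IncreasingAP P

  increasingAP⇒distinct : DistinctCoords v
  increasingAP⇒distinct i j i≢j vᵢ≡vⱼ = i≢j (begin
    i                            ≡⟨ inverseʳ order ⟨
    order ⟨$⟩ʳ (order ⟨$⟩ˡ i)   ≡⟨ cong (order ⟨$⟩ʳ_) (FinP.toℕ-injective rankᵢ≡rankⱼ) ⟩
    order ⟨$⟩ʳ (order ⟨$⟩ˡ j)   ≡⟨ inverseʳ order ⟩
    j                            ∎)
    where
    open ≡-Reasoning
    [rankᵢ-rankⱼ]d≡0d : (+ rank i ℤ.- + rank j) ℤ.* d ≡ 0ℤ ℤ.* d
    [rankᵢ-rankⱼ]d≡0d =
      trans (sym (differences i j)) (trans (cong (ℤ._- v j) vᵢ≡vⱼ) (ℤP.+-inverseʳ (v j)))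
    rankᵢ≡rankⱼ : rank i ≡ rank j
    rankᵢ≡rankⱼ = ℤP.+-injective (ℤP.i-j≡0⇒i≡j _ _ (ℤP.*-cancelʳ-≡ _ _ d [rankᵢ-rankⱼ]d≡0d))

  increasingAP⇒gcdPairs≡d : gcdPairs v ≡ d
  increasingAP⇒gcdPairs≡d =
    cong +_ (ℕD.∣-antisym gcdPairs∣d (gcdPairs-greatest v {d} d∣differences))
    where
    d∣differences : ∀ i j → d ∣ v i ℤ.- v j
    d∣differences i j = ℕD.divides ∣ + rank i ℤ.- + rank j ∣
      (trans (cong ∣_∣ (differences i j)) (ℤP.abs-* (+ rank i ℤ.- + rank j) d))
    gcdPairs∣d : gcdPairs v ∣ d
    gcdPairs∣d = subst (λ x → gcdPairs v ∣ x)
      (trans (cong₂ ℤ._-_ (along (suc zero)) (along zero)) ([a+1d]-[a+0d]≡d first d))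
      (gcdPairs-divides v (order ⟨$⟩ʳ suc zero) (order ⟨$⟩ʳ zero))

  increasingAP⇒minℤ≡first : minℤ v ≡ first
  increasingAP⇒minℤ≡first with m , min≡vₘ ← minℤ-attained v = ℤP.≤-antisym min≤first first≤min
    where
    open ℤP.≤-Reasoning
    min≤first : minℤ v ℤ.≤ first
    min≤first = begin
      minℤ v                    ≤⟨ minℤ-lower v (order ⟨$⟩ʳ zero) ⟩
      v (order ⟨$⟩ʳ zero)       ≡⟨ along zero ⟩
      first ℤ.+ + 0 ℤ.* d       ≡⟨ ℤP.+-identityʳ first ⟩
      first                     ∎
    first≤min : first ℤ.≤ minℤ v
    first≤min = begin
      first                     ≡⟨ ℤP.+-identityʳ first ⟨
      first ℤ.+ + 0 ℤ.* d       ≤⟨ along-mono {l = rank m} z≤n ⟩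
      first ℤ.+ + rank m ℤ.* d  ≡⟨ v≡first+rank*d m ⟨
      v m                       ≡⟨ min≡vₘ ⟨
      minℤ v                    ∎

  increasingAP⇒maxℤ≡last : maxℤ v ≡ first ℤ.+ + suc n ℤ.* d
  increasingAP⇒maxℤ≡last with m , max≡vₘ ← maxℤ-attained v = ℤP.≤-antisym max≤last last≤max
    where
    open ℤP.≤-Reasoning
    max≤last : maxℤ v ℤ.≤ first ℤ.+ + suc n ℤ.* d
    max≤last = begin
      maxℤ v                         ≡⟨ max≡vₘ ⟩
      v m                            ≡⟨ v≡first+rank*d m ⟩
      first ℤ.+ + rank m ℤ.* d       ≤⟨ along-mono (FinP.toℕ≤pred[n] (order ⟨$⟩ˡ m)) ⟩
      first ℤ.+ + suc n ℤ.* d        ∎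
    last≤max : first ℤ.+ + suc n ℤ.* d ℤ.≤ maxℤ v
    last≤max = begin
      first ℤ.+ + suc n ℤ.* d        ≡⟨ cong (λ k → first ℤ.+ + k ℤ.* d) (FinP.toℕ-fromℕ (suc n)) ⟨
      first ℤ.+ + toℕ (fromℕ (suc n)) ℤ.* d ≡⟨ along (fromℕ (suc n)) ⟨
      v (order ⟨$⟩ʳ fromℕ (suc n))   ≤⟨ maxℤ-upper v (order ⟨$⟩ʳ fromℕ (suc n)) ⟩
      maxℤ v                         ∎

  increasingAP⇒ratio : + suc n ℤ.* gcdPairs v ≡ maxℤ v ℤ.- minℤ v
  increasingAP⇒ratio = begin
    + suc n ℤ.* gcdPairs v            ≡⟨ cong (+ suc n ℤ.*_) increasingAP⇒gcdPairs≡d ⟩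
    + suc n ℤ.* d                      ≡⟨ solve 3 (λ a k d → k :* d := (a :+ k :* d) :- a) refl first (+ suc n) d ⟩
    (first ℤ.+ + suc n ℤ.* d) ℤ.- first ≡⟨ cong₂ ℤ._-_ increasingAP⇒maxℤ≡last increasingAP⇒minℤ≡first ⟨
    maxℤ v ℤ.- minℤ v                  ∎
    where
    open ≡-Reasoning
    open ℤSolver.+-*-Solver

-- Levels of an admissible vector: (1) ⇔ (2)

module RatioLevels {n} (v : Fin (suc (suc n)) → ℤ) (distinct : DistinctCoords v)
                   (ρ : ℕ) (ratio : + ρ ℤ.* gcdPairs v ≡ maxℤ v ℤ.- minℤ v) where

  g : ℕ
  g = ∣ gcdPairs v ∣

  g≢0 : g ≢ 0
  g≢0 g≡0 = distinct zero (suc zero) (λ ()) (ℤP.i-j≡0⇒i≡j _ _ (ℤP.∣i∣≡0⇒i≡0 (ℕD.0∣⇒≡0 0∣v₀-v₁)))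
    where
    0∣v₀-v₁ : 0 ℕD.∣ ∣ v zero ℤ.- v (suc zero) ∣
    0∣v₀-v₁ = subst (ℕD._∣ ∣ v zero ℤ.- v (suc zero) ∣) g≡0 (gcdPairs-divides v zero (suc zero))

  instance
    g-nonZero : ℕ.NonZero g
    g-nonZero = ℕ.≢-nonZero g≢0

  height : Fin (suc (suc n)) → ℕ
  height i = ∣ v i ℤ.- minℤ v ∣

  +height≡v-min : ∀ i → + height i ≡ v i ℤ.- minℤ v
  +height≡v-min i = ℤP.0≤i⇒+∣i∣≡i (ℤP.i≤j⇒0≤j-i (minℤ-lower v i))

  height≤ρg : ∀ i → height i ≤ ρ ℕ.* g
  height≤ρg i = ℤP.drop‿+≤+ (begin
    + height i          ≡⟨ +height≡v-min i ⟩
    v i ℤ.- minℤ v      ≤⟨ ℤP.+-monoˡ-≤ (ℤ.- minℤ v) (maxℤ-upper v i) ⟩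
    maxℤ v ℤ.- minℤ v   ≡⟨ ratio ⟨
    + ρ ℤ.* gcdPairs v  ≡⟨ ℤP.pos-* ρ g ⟨
    + (ρ ℕ.* g)         ∎)
    where open ℤP.≤-Reasoning

  height-injective : Injective _≡_ _≡_ height
  height-injective {i} {j} hᵢ≡hⱼ with i FinP.≟ j
  ... | yes i≡j = i≡j
  ... | no i≢j = contradiction vᵢ≡vⱼ (distinct i j i≢j)
    where
    vᵢ≡vⱼ : v i ≡ v j
    vᵢ≡vⱼ = +-cancelʳ-≡ (ℤ.- minℤ v) (v i) (v j)
      (trans (sym (+height≡v-min i)) (trans (cong +_ hᵢ≡hⱼ) (+height≡v-min j)))

  g∣height : ∀ i → g ℕD.∣ height i
  g∣height i with m , min≡vₘ ← minℤ-attained v =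
    subst (λ x → g ℕD.∣ ∣ v i ℤ.- x ∣) (sym min≡vₘ) (gcdPairs-divides v i m)

  level : Fin (suc (suc n)) → ℕ
  level i = ℕD._∣_.quotient (g∣height i)

  height≡level*g : ∀ i → height i ≡ level i ℕ.* g
  height≡level*g i = ℕD._∣_.equality (g∣height i)

  level≤ρ : ∀ i → level i ≤ ρ
  level≤ρ i = ℕP.*-cancelʳ-≤ (level i) ρ g (subst (_≤ ρ ℕ.* g) (height≡level*g i) (height≤ρg i))

  v≡min+level*g : ∀ i → v i ≡ minℤ v ℤ.+ + level i ℤ.* + g
  v≡min+level*g i = begin
    v i                              ≡⟨ solve 2 (λ x m → x := m :+ (x :- m)) refl (v i) (minℤ v) ⟩
    minℤ v ℤ.+ (v i ℤ.- minℤ v)      ≡⟨ cong (λ x → minℤ v ℤ.+ x) (+height≡v-min i) ⟨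
    minℤ v ℤ.+ + height i            ≡⟨ cong (λ h → minℤ v ℤ.+ + h) (height≡level*g i) ⟩
    minℤ v ℤ.+ + (level i ℕ.* g)     ≡⟨ cong (λ x → minℤ v ℤ.+ x) (ℤP.pos-* (level i) g) ⟩
    minℤ v ℤ.+ + level i ℤ.* + g     ∎
    where
    open ≡-Reasoning
    open ℤSolver.+-*-Solver

  levelFin : Fin (suc (suc n)) → Fin (suc ρ)
  levelFin i = fromℕ< (s≤s (level≤ρ i))

  levelFin-injective : Injective _≡_ _≡_ levelFin
  levelFin-injective {i} {j} lᵢ≡lⱼ = height-injective (begin
    height i          ≡⟨ height≡level*g i ⟩
    level i ℕ.* g     ≡⟨ cong (ℕ._* g) levelᵢ≡levelⱼ ⟩
    level j ℕ.* g     ≡⟨ height≡level*g j ⟨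
    height j          ∎)
    where
    open ≡-Reasoning
    levelᵢ≡levelⱼ : level i ≡ level j
    levelᵢ≡levelⱼ = trans (sym (FinP.toℕ-fromℕ< _)) (trans (cong toℕ lᵢ≡lⱼ) (FinP.toℕ-fromℕ< _))

  length≤1+ρ : suc (suc n) ≤ suc ρ
  length≤1+ρ = FinP.injective⇒≤ levelFin-injective

ratio[length-1]⇒increasingAP : ∀ {n} (v : Fin (suc (suc n)) → ℤ) → DistinctCoords v →
                               + suc n ℤ.* gcdPairs v ≡ maxℤ v ℤ.- minℤ v → IncreasingAP v
ratio[length-1]⇒increasingAP {n} v distinct ratio = record
  { order = proj₁ levelFin⁻¹ ; first = minℤ v ; d-1 = ℕ.pred g ; along = along }
  where
  open RatioLevels v distinct (suc n) ratio
  levelFin⁻¹ : Σ (Permutation′ (suc (suc n))) λ σ → ∀ k → levelFin (σ ⟨$⟩ʳ k) ≡ k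
  levelFin⁻¹ = injective⇒inverse levelFin-injective
  along : ∀ k → v (proj₁ levelFin⁻¹ ⟨$⟩ʳ k) ≡ minℤ v ℤ.+ + toℕ k ℤ.* + suc (ℕ.pred g)
  along k = begin
    v (σ ⟨$⟩ʳ k)                              ≡⟨ v≡min+level*g (σ ⟨$⟩ʳ k) ⟩
    minℤ v ℤ.+ + level (σ ⟨$⟩ʳ k) ℤ.* + g      ≡⟨ cong (λ l → minℤ v ℤ.+ + l ℤ.* + g) level[σk]≡k ⟩
    minℤ v ℤ.+ + toℕ k ℤ.* + g                 ≡⟨ cong (λ g → minℤ v ℤ.+ + toℕ k ℤ.* + g) (ℕP.suc-pred g) ⟨
    minℤ v ℤ.+ + toℕ k ℤ.* + suc (ℕ.pred g)    ∎
    where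
    open ≡-Reasoning
    σ = proj₁ levelFin⁻¹
    level[σk]≡k : level (σ ⟨$⟩ʳ k) ≡ toℕ k
    level[σk]≡k = trans (sym (FinP.toℕ-fromℕ< _)) (cong toℕ (proj₂ levelFin⁻¹ k))

ZeroSumAP : ∀ {q} → (Fin q → Fin q → ℕ) → Set
ZeroSumAP {q} M = Σ (Fin q → ℤ) λ w → sumℤ w ≡ 0ℤ × SortedAPNonzero (mulVec M w)

module _ {n} (M : Fin (suc (suc n)) → Fin (suc (suc n)) → ℕ) where

  ratioValue⇒length≤1+ρ : ∀ {ρ} → RatioValue M ρ → suc (suc n) ≤ suc ρ
  ratioValue⇒length≤1+ρ {ρ} (w , _ , distinct , ratio) = RatioLevels.length≤1+ρ (mulVec M w) distinct ρ ratio

  ratioValue[length-1]⇔zeroSumAP : RatioValue M (suc n) ⇔ ZeroSumAP M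
  ratioValue[length-1]⇔zeroSumAP = mk⇔
    (λ (w , Σw≡0 , distinct , ratio) →
      w , Σw≡0 , increasingAP⇒sortedAPNonzero (ratio[length-1]⇒increasingAP (mulVec M w) distinct ratio))
    (λ (w , Σw≡0 , sortedAP) → let P = sortedAPNonzero⇒increasingAP sortedAP in
      w , Σw≡0 , increasingAP⇒distinct P , increasingAP⇒ratio P)

  isR⇔zeroSumAP : IsR M (suc (suc n)) ⇔ ZeroSumAP M
  isR⇔zeroSumAP = mk⇔
    (λ (m , (value , _) , 2+n≡m+1) →
      to (subst (RatioValue M) (sym (ℕP.suc-injective (trans 2+n≡m+1 (ℕP.+-comm m 1)))) value))
    (λ zeroSumAP →
      suc n , (from zeroSumAP , λ _ → ℕ.s≤s⁻¹ ∘ ratioValue⇒length≤1+ρ) , sym (ℕP.+-comm (suc n) 1))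
    where open Equivalence ratioValue[length-1]⇔zeroSumAP

-- ℕ→ℚ n in the definition of the bordered matrix is definitionally ι (+ n).
ι : ℤ → ℚ
ι z = z ℚ./ 1

toℚᵘ-/ : ∀ z n → toℚᵘ (z ℚ./ suc n) ≃ᵘ mkℚᵘ z n
toℚᵘ-/ z n = ℚP.toℚᵘ-fromℚᵘ (mkℚᵘ z n)

ι-homo-+ : ∀ x y → ι (x ℤ.+ y) ≡ ι x ℚ.+ ι y
ι-homo-+ x y = ℚP.toℚᵘ-injective (begin
  toℚᵘ (ι (x ℤ.+ y))              ≈⟨ toℚᵘ-/ (x ℤ.+ y) 0 ⟩
  mkℚᵘ (x ℤ.+ y) 0                ≈⟨ *≡* (solve 2 (λ x y → (x :+ y) :* con (+ 1)
                                                    := (x :* con (+ 1) :+ y :* con (+ 1)) :* con (+ 1)) refl x y) ⟩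
  mkℚᵘ x 0 ℚᵘ.+ mkℚᵘ y 0          ≈⟨ ℚᵘP.+-cong (toℚᵘ-/ x 0) (toℚᵘ-/ y 0) ⟨
  toℚᵘ (ι x) ℚᵘ.+ toℚᵘ (ι y)      ≈⟨ ℚP.toℚᵘ-homo-+ (ι x) (ι y) ⟨
  toℚᵘ (ι x ℚ.+ ι y)              ∎)
  where
  open ℚᵘP.≃-Reasoning
  open ℤSolver.+-*-Solver

ι-homo-* : ∀ x y → ι (x ℤ.* y) ≡ ι x ℚ.* ι y
ι-homo-* x y = ℚP.toℚᵘ-injective (begin
  toℚᵘ (ι (x ℤ.* y))              ≈⟨ toℚᵘ-/ (x ℤ.* y) 0 ⟩
  mkℚᵘ (x ℤ.* y) 0                ≈⟨ *≡* refl ⟩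
  mkℚᵘ x 0 ℚᵘ.* mkℚᵘ y 0          ≈⟨ ℚᵘP.*-cong (toℚᵘ-/ x 0) (toℚᵘ-/ y 0) ⟨
  toℚᵘ (ι x) ℚᵘ.* toℚᵘ (ι y)      ≈⟨ ℚP.toℚᵘ-homo-* (ι x) (ι y) ⟨
  toℚᵘ (ι x ℚ.* ι y)              ∎)
  where open ℚᵘP.≃-Reasoning

ι-injective : ∀ {x y} → ι x ≡ ι y → x ≡ y
ι-injective {x} {y} ιx≡ιy
  with *≡* x*1≡y*1 ← ℚᵘP.≃-trans (ℚᵘP.≃-sym (toℚᵘ-/ x 0)) (ℚᵘP.≃-trans (ℚP.toℚᵘ-cong ιx≡ιy) (toℚᵘ-/ y 0))
  = trans (sym (ℤP.*-identityʳ x)) (trans x*1≡y*1 (ℤP.*-identityʳ y))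

ι[n]*[z/n]≡ι[z] : ∀ n z → ι (+ suc n) ℚ.* (z ℚ./ suc n) ≡ ι z
ι[n]*[z/n]≡ι[z] n z = ℚP.toℚᵘ-injective (begin
  toℚᵘ (ι (+ suc n) ℚ.* (z ℚ./ suc n))        ≈⟨ ℚP.toℚᵘ-homo-* (ι (+ suc n)) (z ℚ./ suc n) ⟩
  toℚᵘ (ι (+ suc n)) ℚᵘ.* toℚᵘ (z ℚ./ suc n)  ≈⟨ ℚᵘP.*-cong (toℚᵘ-/ (+ suc n) 0) (toℚᵘ-/ z n) ⟩
  mkℚᵘ (+ suc n) 0 ℚᵘ.* mkℚᵘ z n               ≈⟨ *≡* (trans (solve 2 (λ n z → (n :* z) :* con (+ 1) := z :* n) refl (+ suc n) z)
                                                               (cong (λ k → z ℤ.* + suc k) (sym (ℕP.+-identityʳ n)))) ⟩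
  mkℚᵘ z 0                                     ≈⟨ toℚᵘ-/ z 0 ⟨
  toℚᵘ (ι z)                                   ∎)
  where
  open ℚᵘP.≃-Reasoning
  open ℤSolver.+-*-Solver

ι-↥ : ∀ p → ι (ℚ.↥ p) ≡ ι (+ ℚ.↧ₙ p) ℚ.* p
ι-↥ p = trans (sym (ι[n]*[z/n]≡ι[z] (ℚ.denominator-1 p) (ℚ.↥ p)))
              (cong (ι (+ ℚ.↧ₙ p) ℚ.*_) (ℚP.↥p/↧p≡p p))

ι[a+kd] : ∀ a k d → ι (a ℤ.+ k ℤ.* d) ≡ ι a ℚ.+ ι k ℚ.* ι d
ι[a+kd] a k d = trans (ι-homo-+ a (k ℤ.* d)) (cong (ι a ℚ.+_) (ι-homo-* k d))

sumℚ-cong : ∀ {n} {f g : Fin n → ℚ} → (∀ j → f j ≡ g j) → sumℚ f ≡ sumℚ g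
sumℚ-cong {zero}  f≗g = refl
sumℚ-cong {suc n} f≗g = cong₂ ℚ._+_ (f≗g zero) (sumℚ-cong (f≗g ∘ suc))

sumℚ-*ˡ : ∀ {n} c (f : Fin n → ℚ) → sumℚ (λ j → c ℚ.* f j) ≡ c ℚ.* sumℚ f
sumℚ-*ˡ {zero}  c f = sym (ℚP.*-zeroʳ c)
sumℚ-*ˡ {suc n} c f =
  trans (cong (c ℚ.* f zero ℚ.+_) (sumℚ-*ˡ c (f ∘ suc))) (sym (ℚP.*-distribˡ-+ c (f zero) _))

sumℚ-ι : ∀ {n} (f : Fin n → ℤ) → sumℚ (ι ∘ f) ≡ ι (sumℤ f)
sumℚ-ι {zero}  f = refl
sumℚ-ι {suc n} f = trans (cong (ι (f zero) ℚ.+_) (sumℚ-ι (f ∘ suc))) (sym (ι-homo-+ (f zero) _))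

sumℚ-split : ∀ q (f : Fin (q ℕ.+ 1) → ℚ) → sumℚ f ≡ sumℚ (λ j → f (j ↑ˡ 1)) ℚ.+ f (q ↑ʳ zero)
sumℚ-split zero    f = trans (ℚP.+-identityʳ (f zero)) (sym (ℚP.+-identityˡ (f zero)))
sumℚ-split (suc q) f =
  trans (cong (f zero ℚ.+_) (sumℚ-split q (f ∘ suc))) (sym (ℚP.+-assoc (f zero) _ _))

mulVecℚ : ∀ {q} → (Fin q → Fin q → ℕ) → (Fin q → ℚ) → Fin q → ℚ
mulVecℚ M y i = sumℚ (λ j → ℕ→ℚ (M i j) ℚ.* y j)

ι-mulVec : ∀ {q} (M : Fin q → Fin q → ℕ) w i → ι (mulVec M w i) ≡ mulVecℚ M (ι ∘ w) i
ι-mulVec M w i =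
  trans (sym (sumℚ-ι (λ j → + M i j ℤ.* w j))) (sumℚ-cong λ j → ι-homo-* (+ M i j) (w j))

mulVecℚ-cong : ∀ {q} (M : Fin q → Fin q → ℕ) {y z} → (∀ j → y j ≡ z j) → ∀ i → mulVecℚ M y i ≡ mulVecℚ M z i
mulVecℚ-cong M y≗z i = sumℚ-cong λ j → cong (ℕ→ℚ (M i j) ℚ.*_) (y≗z j)

mulVecℚ-*ˡ : ∀ {q} (M : Fin q → Fin q → ℕ) c y i → mulVecℚ M (λ j → c ℚ.* y j) i ≡ c ℚ.* mulVecℚ M y i
mulVecℚ-*ˡ M c y i =
  trans (sumℚ-cong λ j → xyz≡yxz (ℕ→ℚ (M i j)) c (y j)) (sumℚ-*ˡ c (λ j → ℕ→ℚ (M i j) ℚ.* y j))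
  where
  open ℚSolver.+-*-Solver
  xyz≡yxz : ∀ x y z → x ℚ.* (y ℚ.* z) ≡ y ℚ.* (x ℚ.* z)
  xyz≡yxz = solve 3 (λ x y z → x :* (y :* z) := y :* (x :* z)) refl

-- The bordered system: (2) ⇔ (3)

↑ˡ-↑ʳ-elim : ∀ {m n} (P : Fin (m ℕ.+ n) → Set) →
             (∀ i → P (i ↑ˡ n)) → (∀ j → P (m ↑ʳ j)) → ∀ k → P k
↑ˡ-↑ʳ-elim {m} {n} P left right k with splitAt m k | FinP.join-splitAt m n k
... | inj₁ i | refl = left i
... | inj₂ j | refl = right j

module _ {q} (M : Fin q → Fin q → ℕ) where

  bordered-↑ˡ-↑ˡ : ∀ i j → bordered M (i ↑ˡ 1) (j ↑ˡ 1) ≡ ℕ→ℚ (M i j)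
  bordered-↑ˡ-↑ˡ i j rewrite FinP.splitAt-↑ˡ q i 1 | FinP.splitAt-↑ˡ q j 1 = refl

  bordered-↑ˡ-↑ʳ : ∀ i → bordered M (i ↑ˡ 1) (q ↑ʳ zero) ≡ ℚ.1ℚ
  bordered-↑ˡ-↑ʳ i rewrite FinP.splitAt-↑ˡ q i 1 | FinP.splitAt-↑ʳ q 1 zero = refl

  bordered-↑ʳ-↑ˡ : ∀ j → bordered M (q ↑ʳ zero) (j ↑ˡ 1) ≡ ℚ.1ℚ
  bordered-↑ʳ-↑ˡ j rewrite FinP.splitAt-↑ʳ q 1 zero | FinP.splitAt-↑ˡ q j 1 = refl

  bordered-↑ʳ-↑ʳ : bordered M (q ↑ʳ zero) (q ↑ʳ zero) ≡ ℚ.0ℚ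
  bordered-↑ʳ-↑ʳ rewrite FinP.splitAt-↑ʳ q 1 zero = refl

  module _ (x : Fin (q ℕ.+ 1) → ℚ) where
    open ≡-Reasoning

    bordered-row : ∀ i → sumℚ (λ l → bordered M (i ↑ˡ 1) l ℚ.* x l) ≡
                         mulVecℚ M (λ j → x (j ↑ˡ 1)) i ℚ.+ x (q ↑ʳ zero)
    bordered-row i = begin
      sumℚ (λ l → bordered M (i ↑ˡ 1) l ℚ.* x l)
        ≡⟨ sumℚ-split q _ ⟩
      sumℚ (λ j → bordered M (i ↑ˡ 1) (j ↑ˡ 1) ℚ.* x (j ↑ˡ 1))
        ℚ.+ bordered M (i ↑ˡ 1) (q ↑ʳ zero) ℚ.* x (q ↑ʳ zero)
        ≡⟨ cong₂ ℚ._+_ (sumℚ-cong λ j → cong (ℚ._* x (j ↑ˡ 1)) (bordered-↑ˡ-↑ˡ i j))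
                       (trans (cong (ℚ._* x (q ↑ʳ zero)) (bordered-↑ˡ-↑ʳ i)) (ℚP.*-identityˡ _)) ⟩
      mulVecℚ M (λ j → x (j ↑ˡ 1)) i ℚ.+ x (q ↑ʳ zero) ∎

    bordered-lastRow : sumℚ (λ l → bordered M (q ↑ʳ zero) l ℚ.* x l) ≡ sumℚ (λ j → x (j ↑ˡ 1))
    bordered-lastRow = begin
      sumℚ (λ l → bordered M (q ↑ʳ zero) l ℚ.* x l)
        ≡⟨ sumℚ-split q _ ⟩
      sumℚ (λ j → bordered M (q ↑ʳ zero) (j ↑ˡ 1) ℚ.* x (j ↑ˡ 1))
        ℚ.+ bordered M (q ↑ʳ zero) (q ↑ʳ zero) ℚ.* x (q ↑ʳ zero)
        ≡⟨ cong₂ ℚ._+_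
             (sumℚ-cong λ j → trans (cong (ℚ._* x (j ↑ˡ 1)) (bordered-↑ʳ-↑ˡ j)) (ℚP.*-identityˡ _))
             (trans (cong (ℚ._* x (q ↑ʳ zero)) bordered-↑ʳ-↑ʳ) (ℚP.*-zeroˡ (x (q ↑ʳ zero)))) ⟩
      sumℚ (λ j → x (j ↑ˡ 1)) ℚ.+ ℚ.0ℚ
        ≡⟨ ℚP.+-identityʳ _ ⟩
      sumℚ (λ j → x (j ↑ˡ 1)) ∎

infixl 5 _∷ʳ_

_∷ʳ_ : ∀ {q} → (Fin q → ℚ) → ℚ → Fin (q ℕ.+ 1) → ℚ
_∷ʳ_ {q} y c = [ y , (λ _ → c) ] ∘ splitAt q

∷ʳ-↑ˡ : ∀ {q} (y : Fin q → ℚ) c j → (y ∷ʳ c) (j ↑ˡ 1) ≡ y j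
∷ʳ-↑ˡ {q} y c j = cong [ y , (λ _ → c) ] (FinP.splitAt-↑ˡ q j 1)

∷ʳ-↑ʳ : ∀ {q} (y : Fin q → ℚ) c → (y ∷ʳ c) (q ↑ʳ zero) ≡ c
∷ʳ-↑ʳ {q} y c = cong [ y , (λ _ → c) ] (FinP.splitAt-↑ʳ q 1 zero)

BorderedSolution : ∀ {q} → (Fin q → Fin q → ℕ) → (Fin (q ℕ.+ 1) → ℚ) → Set
BorderedSolution {q} M b = Σ (Fin q → ℚ) λ y → Σ ℚ λ c →
  (∀ i → mulVecℚ M y i ℚ.+ c ≡ b (i ↑ˡ 1)) × sumℚ y ≡ b (q ↑ʳ zero)

inColumnSpace-bordered⇔ : ∀ {q} (M : Fin q → Fin q → ℕ) b →
                          InColumnSpace (bordered M) b ⇔ BorderedSolution M b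
inColumnSpace-bordered⇔ {q} M b = mk⇔
  (λ (x , Ax≡b) → (λ j → x (j ↑ˡ 1)) , x (q ↑ʳ zero) ,
    (λ i → trans (sym (bordered-row M x i)) (Ax≡b (i ↑ˡ 1))) ,
    trans (sym (bordered-lastRow M x)) (Ax≡b (q ↑ʳ zero)))
  (λ (y , c , rows , lastRow) → y ∷ʳ c , ↑ˡ-↑ʳ-elim _
    (λ i → trans (bordered-row M (y ∷ʳ c) i)
             (trans (cong₂ ℚ._+_ (mulVecℚ-cong M (∷ʳ-↑ˡ y c) i) (∷ʳ-↑ʳ y c)) (rows i)))
    λ { zero → trans (bordered-lastRow M (y ∷ʳ c)) (trans (sumℚ-cong (∷ʳ-↑ˡ y c)) lastRow) })

permVec-↑ˡ : ∀ {q} (π : Permutation′ q) i → permVec π (i ↑ˡ 1) ≡ ι (+ suc (toℕ (π ⟨$⟩ʳ i)))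
permVec-↑ˡ {q} π i rewrite FinP.splitAt-↑ˡ q i 1 = refl

permVec-↑ʳ : ∀ {q} (π : Permutation′ q) → permVec π (q ↑ʳ zero) ≡ ℚ.0ℚ
permVec-↑ʳ {q} π rewrite FinP.splitAt-↑ʳ q 1 zero = refl

increasingAP⇒borderedSolution : ∀ {q} (M : Fin q → Fin q → ℕ) {w} → sumℤ w ≡ 0ℤ →
                                (P : IncreasingAP (mulVec M w)) →
                                BorderedSolution M (permVec (flip (IncreasingAP.order P)))
increasingAP⇒borderedSolution M {w} Σw≡0 P = y , c , rows , Σy≡0
  where
  open IncreasingAP P
  open ≡-Reasoning
  open ℚSolver.+-*-Solver
  e : ℚ
  e = + 1 ℚ./ suc d-1
  y : Fin _ → ℚ
  y j = e ℚ.* ι (w j)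
  c : ℚ
  c = ℚ.1ℚ ℚ.- e ℚ.* ι first

  rows : ∀ i → mulVecℚ M y i ℚ.+ c ≡ permVec (flip order) (i ↑ˡ 1)
  rows i = begin
    mulVecℚ M y i ℚ.+ c
      ≡⟨ cong (ℚ._+ c) (trans (mulVecℚ-*ˡ M e (ι ∘ w) i) (sym (cong (e ℚ.*_) (ι-mulVec M w i)))) ⟩
    e ℚ.* ι (mulVec M w i) ℚ.+ c
      ≡⟨ cong (λ t → e ℚ.* t ℚ.+ c) (trans (cong ι (v≡first+rank*d i)) (ι[a+kd] first (+ rank i) d)) ⟩
    e ℚ.* (ι first ℚ.+ ι (+ rank i) ℚ.* ι d) ℚ.+ (ℚ.1ℚ ℚ.- e ℚ.* ι first)
      ≡⟨ solve 4 (λ e a r d → e :* (a :+ r :* d) :+ (con ℚ.1ℚ :- e :* a) := con ℚ.1ℚ :+ r :* (d :* e))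
                 refl e (ι first) (ι (+ rank i)) (ι d) ⟩
    ℚ.1ℚ ℚ.+ ι (+ rank i) ℚ.* (ι d ℚ.* e)
      ≡⟨ cong (λ t → ℚ.1ℚ ℚ.+ ι (+ rank i) ℚ.* t) (ι[n]*[z/n]≡ι[z] d-1 (+ 1)) ⟩
    ℚ.1ℚ ℚ.+ ι (+ rank i) ℚ.* ℚ.1ℚ
      ≡⟨ cong (ℚ.1ℚ ℚ.+_) (ℚP.*-identityʳ (ι (+ rank i))) ⟩
    ι (+ 1) ℚ.+ ι (+ rank i)
      ≡⟨ trans (permVec-↑ˡ (flip order) i) (ι-homo-+ (+ 1) (+ rank i)) ⟨
    permVec (flip order) (i ↑ˡ 1) ∎

  Σy≡0 : sumℚ y ≡ permVec (flip order) (_ ↑ʳ zero)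
  Σy≡0 = begin
    sumℚ y                           ≡⟨ sumℚ-*ˡ e (ι ∘ w) ⟩
    e ℚ.* sumℚ (ι ∘ w)               ≡⟨ cong (e ℚ.*_) (trans (sumℚ-ι w) (cong ι Σw≡0)) ⟩
    e ℚ.* ℚ.0ℚ                       ≡⟨ ℚP.*-zeroʳ e ⟩
    ℚ.0ℚ                             ≡⟨ permVec-↑ʳ (flip order) ⟨
    permVec (flip order) (_ ↑ʳ zero) ∎

clearDenominators : ∀ {n} (y : Fin n → ℚ) →
                    ∃[ D ] Σ (Fin n → ℤ) λ w → ∀ j → ι (w j) ≡ ι (+ suc D) ℚ.* y j
clearDenominators {zero}  y = 0 , (λ ()) , λ ()
clearDenominators {suc n} y with D , w , ιw≡Dy ← clearDenominators (y ∘ suc) =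
  D ℕ.+ e ℕ.* suc D , w′ , ιw′≡ED*y
  where
  open ≡-Reasoning
  open ℚSolver.+-*-Solver
  e : ℕ
  e = ℚ.denominator-1 (y zero)
  ι[ED]≡ιE*ιD : ι (+ suc (D ℕ.+ e ℕ.* suc D)) ≡ ι (+ suc e) ℚ.* ι (+ suc D)
  ι[ED]≡ιE*ιD = trans (cong ι (ℤP.pos-* (suc e) (suc D))) (ι-homo-* (+ suc e) (+ suc D))
  w′ : Fin (suc n) → ℤ
  w′ zero    = ℚ.↥ (y zero) ℤ.* + suc D
  w′ (suc j) = w j ℤ.* + suc e
  ιw′≡ED*y : ∀ j → ι (w′ j) ≡ ι (+ suc (D ℕ.+ e ℕ.* suc D)) ℚ.* y j
  ιw′≡ED*y zero = begin
    ι (ℚ.↥ (y zero) ℤ.* + suc D)                ≡⟨ ι-homo-* (ℚ.↥ (y zero)) (+ suc D) ⟩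
    ι (ℚ.↥ (y zero)) ℚ.* ι (+ suc D)            ≡⟨ cong (ℚ._* ι (+ suc D)) (ι-↥ (y zero)) ⟩
    ι (+ suc e) ℚ.* y zero ℚ.* ι (+ suc D)      ≡⟨ solve 3 (λ E D y → E :* y :* D := E :* D :* y)
                                                          refl (ι (+ suc e)) (ι (+ suc D)) (y zero) ⟩
    ι (+ suc e) ℚ.* ι (+ suc D) ℚ.* y zero      ≡⟨ cong (ℚ._* y zero) ι[ED]≡ιE*ιD ⟨
    ι (+ suc (D ℕ.+ e ℕ.* suc D)) ℚ.* y zero    ∎
  ιw′≡ED*y (suc j) = begin
    ι (w j ℤ.* + suc e)                         ≡⟨ ι-homo-* (w j) (+ suc e) ⟩
    ι (w j) ℚ.* ι (+ suc e)                     ≡⟨ cong (ℚ._* ι (+ suc e)) (ιw≡Dy j) ⟩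
    ι (+ suc D) ℚ.* y (suc j) ℚ.* ι (+ suc e)   ≡⟨ solve 3 (λ E D y → D :* y :* E := E :* D :* y)
                                                          refl (ι (+ suc e)) (ι (+ suc D)) (y (suc j)) ⟩
    ι (+ suc e) ℚ.* ι (+ suc D) ℚ.* y (suc j)   ≡⟨ cong (ℚ._* y (suc j)) ι[ED]≡ιE*ιD ⟨
    ι (+ suc (D ℕ.+ e ℕ.* suc D)) ℚ.* y (suc j) ∎

borderedSolution⇒increasingAP : ∀ {n} (M : Fin (suc n) → Fin (suc n) → ℕ) π →
                                BorderedSolution M (permVec π) →
                                Σ (Fin (suc n) → ℤ) λ w → sumℤ w ≡ 0ℤ × IncreasingAP (mulVec M w)
borderedSolution⇒increasingAP {n} M π (y , c , rows , Σy≡0)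
  with D , w , ιw≡Dy ← clearDenominators y = w , Σw≡0 , record
  { order = flip π ; first = v (flip π ⟨$⟩ʳ zero) ; d-1 = D ; along = along }
  where
  open ≡-Reasoning
  open ℚSolver.+-*-Solver
  v : Fin (suc n) → ℤ
  v = mulVec M w
  Dq : ℚ
  Dq = ι (+ suc D)

  Σw≡0 : sumℤ w ≡ 0ℤ
  Σw≡0 = ι-injective (begin
    ι (sumℤ w)              ≡⟨ sumℚ-ι w ⟨
    sumℚ (ι ∘ w)            ≡⟨ sumℚ-cong ιw≡Dy ⟩
    sumℚ (λ j → Dq ℚ.* y j) ≡⟨ sumℚ-*ˡ Dq y ⟩
    Dq ℚ.* sumℚ y           ≡⟨ cong (Dq ℚ.*_) (trans Σy≡0 (permVec-↑ʳ π)) ⟩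
    Dq ℚ.* ℚ.0ℚ             ≡⟨ ℚP.*-zeroʳ Dq ⟩
    ι 0ℤ                    ∎)

  ιv≡ : ∀ i → ι (v i) ≡ Dq ℚ.* (ι (+ suc (toℕ (π ⟨$⟩ʳ i))) ℚ.- c)
  ιv≡ i = begin
    ι (v i)
      ≡⟨ trans (ι-mulVec M w i) (mulVecℚ-cong M ιw≡Dy i) ⟩
    mulVecℚ M (λ j → Dq ℚ.* y j) i
      ≡⟨ mulVecℚ-*ˡ M Dq y i ⟩
    Dq ℚ.* mulVecℚ M y i
      ≡⟨ cong (Dq ℚ.*_) (solve 2 (λ a c → a := (a :+ c) :- c) refl (mulVecℚ M y i) c) ⟩
    Dq ℚ.* (mulVecℚ M y i ℚ.+ c ℚ.- c)
      ≡⟨ cong (λ t → Dq ℚ.* (t ℚ.- c)) (trans (rows i) (permVec-↑ˡ π i)) ⟩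
    Dq ℚ.* (ι (+ suc (toℕ (π ⟨$⟩ʳ i))) ℚ.- c) ∎

  ιv[σk]≡ : ∀ k → ι (v (flip π ⟨$⟩ʳ k)) ≡ Dq ℚ.* (ι (+ suc (toℕ k)) ℚ.- c)
  ιv[σk]≡ k = trans (ιv≡ (π ⟨$⟩ˡ k)) (cong (λ t → Dq ℚ.* (ι (+ suc (toℕ t)) ℚ.- c)) (inverseʳ π))

  along : ∀ k → v (flip π ⟨$⟩ʳ k) ≡ v (flip π ⟨$⟩ʳ zero) ℤ.+ + toℕ k ℤ.* + suc D
  along k = ι-injective (begin
    ι (v (flip π ⟨$⟩ʳ k))
      ≡⟨ trans (ιv[σk]≡ k) (cong (λ t → Dq ℚ.* (t ℚ.- c)) (ι-homo-+ (+ 1) (+ toℕ k))) ⟩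
    Dq ℚ.* (ℚ.1ℚ ℚ.+ ι (+ toℕ k) ℚ.- c)
      ≡⟨ solve 3 (λ D k c → D :* (con ℚ.1ℚ :+ k :- c) := D :* (con ℚ.1ℚ :- c) :+ k :* D) refl Dq (ι (+ toℕ k)) c ⟩
    Dq ℚ.* (ℚ.1ℚ ℚ.- c) ℚ.+ ι (+ toℕ k) ℚ.* Dq
      ≡⟨ cong (ℚ._+ ι (+ toℕ k) ℚ.* Dq) (ιv[σk]≡ zero) ⟨
    ι (v (flip π ⟨$⟩ʳ zero)) ℚ.+ ι (+ toℕ k) ℚ.* Dq
      ≡⟨ ι[a+kd] (v (flip π ⟨$⟩ʳ zero)) (+ toℕ k) (+ suc D) ⟨
    ι (v (flip π ⟨$⟩ʳ zero) ℤ.+ + toℕ k ℤ.* + suc D) ∎)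

zeroSumAP⇔perm∈columnSpace : ∀ {n} (M : Fin (suc (suc n)) → Fin (suc (suc n)) → ℕ) →
                             ZeroSumAP M ⇔
                             (Σ (Permutation′ (suc (suc n))) λ π → InColumnSpace (bordered M) (permVec π))
zeroSumAP⇔perm∈columnSpace M = mk⇔
  (λ (w , Σw≡0 , sortedAP) → let P = sortedAPNonzero⇒increasingAP sortedAP in
    flip (IncreasingAP.order P) ,
    Equivalence.from (inColumnSpace-bordered⇔ M _) (increasingAP⇒borderedSolution M {w} Σw≡0 P))
  (λ (π , Ax≡π) →
    let w , Σw≡0 , P =
          borderedSolution⇒increasingAP M π (Equivalence.to (inColumnSpace-bordered⇔ M _) Ax≡π) in
    w , Σw≡0 , increasingAP⇒sortedAPNonzero P)

lemma4p1 : (q : ℕ) → 2 ≤ q → (G : Graph q) → Connected G →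
           (M : Fin q → Fin q → ℕ) → IsDistanceMatrix G M →
           (IsR M q ⇔ (Σ (Fin q → ℤ) λ w → sumℤ w ≡ 0ℤ × SortedAPNonzero (mulVec M w)))
           × ((Σ (Fin q → ℤ) λ w → sumℤ w ≡ 0ℤ × SortedAPNonzero (mulVec M w))
                ⇔ (Σ (Permutation′ q) λ π → InColumnSpace (bordered M) (permVec π)))
lemma4p1 (suc (suc n)) (s≤s (s≤s z≤n)) _ _ M _ = isR⇔zeroSumAP M , zeroSumAP⇔perm∈columnSpace M
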